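{- Let $\mathcal{A}=(Q,\delta,I,F)$ be a Büchi automaton. Then $\preceq_{R}\ \subseteq\ \preceq_{\mathrm{ors}}$, i.e., for all $p,r\in Q$, if $p\preceq_R r$ then $p\preceq_{\mathrm{ors}} r$.
   Context: Fix a finite nonempty alphabet $\Sigma$; infinite words are $\alpha=\alpha_0\alpha_1\cdots\in\Sigma^\omega$. A Büchi automaton (BA) is $\mathcal{A}=(Q,\delta,I,F)$ with finite state set $Q$, transition function $\delta:Q\times\Sigma\to 2^Q$, initial states $I\subseteq Q$ and accepting states $F\subseteq Q$. A run from $q$ on $\alpha$ is a sequence $\rho_0\rho_1\cdots$ with $\rho_0=q$ and $\rho_{i+1}\in\delta(\rho_i,\alpha_i)$. Let $n=|Q|$. Run DAG and ranks: the run DAG $\mathcal{G}_\alpha$ of $\mathcal{A}$ over $\alpha$ has vertices $(q,i)\in Q\times\omega$ such that some run of $\mathcal{A}$ from a state of $I$ on $\alpha$ has $\rho_i=q$, and edges $((q,i),(q',i+1))$ with $q'\in\delta(q,\alpha_i)$. A vertex is accepting if its state is in $F$, finite if only finitely many vertices are reachable from it, endangered if it cannot reach an accepting vertex. Let $\mathcal{G}^0=\mathcal{G}_\alpha$, $j=0$, and repeat until a fixpoint or for at most $2n+1$ steps: assign rank $j$ to all finite vertices of $\mathcal{G}^j$ and let $\mathcal{G}^{j+1}$ be $\mathcal{G}^j$ without them; assign rank $j+1$ to all endangered vertices of $\mathcal{G}^{j+1}$ and let $\mathcal{G}^{j+2}$ be $\mathcal{G}^{j+1}$ without them; set $j:=j+2$.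 Remaining vertices get rank $\omega$. Write $\mathrm{rank}_\alpha(q,i)$ for the rank of $(q,i)$. Direct simulation: $\preceq_{di}\subseteq Q\times Q$ is the largest relation such that $p\preceq_{di} q$ implies (i) $p\in F\Rightarrow q\in F$ and (ii) for every $a\in\Sigma$ and $p'\in\delta(p,a)$ there is $q'\in\delta(q,a)$ with $p'\preceq_{di} q'$. Odd-rank simulation: $p\preceq_{\mathrm{ors}} r$ iff for all $\alpha\in\Sigma^\omega$ and all $i\ge 0$ such that $(p,i)$ and $(r,i)$ are vertices of $\mathcal{G}_\alpha$ with $\mathrm{rank}_\alpha(p,i)$ and $\mathrm{rank}_\alpha(r,i)$ both odd, we have $\mathrm{rank}_\alpha(p,i)\le\mathrm{rank}_\alpha(r,i)$. The relation $\preceq_R$ is the smallest binary relation on $Q$ such that (i) $\preceq_{di}\subseteq\preceq_R$, and (ii) for $p,r\in Q$, if for every $a\in\Sigma$, every $x\in\delta(p,a)\setminus F$ and every $y\in\delta(r,a)\setminus F$ we have $x\preceq_R y$, then $p\preceq_R r$. -}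

module Defs where

open import Level using (0ℓ)
open import Data.Nat using (ℕ; zero; suc; _+_; _*_; _≤_; _%_)
open import Data.Bool using (Bool; true; false; if_then_else_)
open import Data.Fin using (Fin)
open import Data.Fin.Subset using (Subset; _∈_; _∉_)
open import Data.Product using (Σ; ∃; _×_; _,_; proj₁; proj₂)
open import Data.List using (List)
import Data.List.Membership.Propositional as LM
open import Relation.Nullary using (¬_)
open import Relation.Binary.PropositionalEquality using (_≡_)

record BA (n k : ℕ) : Set where
  field
    δ : Fin n → Fin k → Subset n
    I : Subset n
    F : Subset n

Word : ℕ → Set
Word k = ℕ → Fin k

V : ℕ → Set
V n = Fin n × ℕ

data Rank : Set where
  fin : ℕ → Rank
  ω   : Rank

Odd : ℕ → Set
Odd j = j % 2 ≡ 1

even? : ℕ → Bool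
even? zero = true
even? (suc zero) = false
even? (suc (suc j)) = even? j

module _ {n k : ℕ} (A : BA n k) where
  open BA A

  IsRun : Word k → (ℕ → Fin n) → Set
  IsRun α ρ = ∀ i → ρ (suc i) ∈ δ (ρ i) (α i)

  Vertex : Word k → V n → Set
  Vertex α (q , i) = Σ (ℕ → Fin n) λ ρ → ρ 0 ∈ I × IsRun α ρ × ρ i ≡ q

  Edge : Word k → V n → V n → Set
  Edge α (q , i) (q' , i') =
    Vertex α (q , i) × Vertex α (q' , i') × i' ≡ suc i × q' ∈ δ q (α i)

  data Reach (α : Word k) (G : V n → Set) : V n → V n → Set where
    here : ∀ {v} → G v → Reach α G v v
    next : ∀ {u v w} → G u → Edge α u v → Reach α G v w → Reach α G u w

  IsFinite : Word k → (V n → Set) → V n → Set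
  IsFinite α G v = Σ (List (V n)) λ L → ∀ w → Reach α G v w → w LM.∈ L

  Endangered : Word k → (V n → Set) → V n → Set
  Endangered α G v = ¬ (Σ (V n) λ w → Reach α G v w × proj₁ w ∈ F)

  mutual
    InG : Word k → ℕ → V n → Set
    InG α zero v = Vertex α v
    InG α (suc j) v = InG α j v × ¬ Removed α j v

    Removed : Word k → ℕ → V n → Set
    Removed α j v with even? j
    ... | true  = IsFinite α (InG α j) v
    ... | false = Endangered α (InG α j) v

  -- the loop is run for 2n+1 iterations (j = 0, 2, …, 4n), assigning
  -- ranks 0 … 4n+1; everything in G^(4n+2) gets rank ω.
  HasRank : Word k → V n → Rank → Set
  HasRank α v (fin j) = j ≤ 4 * n + 1 × InG α j v × Removed α j v
  HasRank α v ω = InG α (4 * n + 2) v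

  -- direct simulation: the largest relation with the two closure properties,
  -- i.e. the union of all direct simulations
  IsDirectSim : (Fin n → Fin n → Set) → Set
  IsDirectSim R = ∀ p q → R p q →
    (p ∈ F → q ∈ F) ×
    (∀ a p' → p' ∈ δ p a → Σ (Fin n) λ q' → q' ∈ δ q a × R p' q')

  _≼di_ : Fin n → Fin n → Set₁
  p ≼di q = Σ (Fin n → Fin n → Set) λ R → IsDirectSim R × R p q

  _≼ors_ : Fin n → Fin n → Set
  p ≼ors r = ∀ (α : Word k) (i j l : ℕ) →
    Vertex α (p , i) → Vertex α (r , i) →
    HasRank α (p , i) (fin j) → HasRank α (r , i) (fin l) →
    Odd j → Odd l → j ≤ l

  data _≼R_ : Fin n → Fin n → Set₁ where
    di   : ∀ {p q} → p ≼di q → p ≼R q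
    step : ∀ {p r} →
      (∀ a x y → x ∈ δ p a → x ∉ F → y ∈ δ r a → y ∉ F → x ≼R y) →
      p ≼R r

{-# OPTIONS --safe #-}
-- For a direct simulation R, every G^j is closed under R from p to r: whatever p reaches in G^j
-- is matched, level by level, by what r reaches, so if (r,i) is finite or endangered in G^j so is
-- (p,i). Hence R p r forces rank(p,i) ≤ rank(r,i). For rule (ii), a vertex of odd rank j'+1 is
-- infinite in G^j', so one of its finitely many successors is too; that successor survives into
-- G^(j'+1), where it inherits endangeredness, so it is non-accepting of the same rank. Induction
-- on ≼R then compares such successors of p and r. The successor exists only under double
-- negation (membership in G^j is undecidable), which suffices since j ≤ l is decidable.
module Submission where

open import Defs
open import Data.Nat using (ℕ; zero; suc; _+_; _≤_; _≤′_; ≤′-refl; ≤′-step; s≤s; _≤?_)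
open import Data.Nat.Properties using (≤-totalOrder; ≤⇒≤′; ≮⇒≥; +-suc; +-identityʳ)
open import Data.Fin using (Fin)
open import Data.Fin.Subset using (_∈_; _∉_)
open import Data.Bool using (true; false)
open import Data.Product using (Σ; _×_; _,_; proj₁; proj₂)
open import Data.List using (List; []; _∷_; map; allFin; upTo; concatMap; cartesianProduct)
import Data.List.Membership.Propositional as List
open import Data.List.Membership.Propositional.Properties
  using (∈-map⁺; ∈-allFin; ∈-upTo⁺; ∈-concatMap⁺; ∈-cartesianProduct⁺)
open import Data.List.Relation.Unary.Any using (here; there)
import Data.List.Relation.Unary.All as All
open import Data.List.Extrema ≤-totalOrder using (max; xs≤max)
open import Data.Empty using (⊥-elim)
open import Function using (_∘_)
open import Relation.Nullary using (¬_)
open import Relation.Nullary.Negation using (¬¬-map)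
open import Relation.Nullary.Decidable using (decidable-stable)
open import Relation.Binary.PropositionalEquality using (_≡_; refl; sym; trans; subst; cong)

even?-odd : ∀ j → Odd j → even? j ≡ false
even?-odd (suc zero) _ = refl
even?-odd (suc (suc j)) o = even?-odd j o

even?-pred : ∀ j → even? (suc j) ≡ false → even? j ≡ true
even?-pred zero _ = refl
even?-pred (suc (suc j)) e = even?-pred j e

¬¬-premise : {X B : Set} {P : X → Set} → X → (B → ¬ ¬ Σ X P) → ¬ ¬ Σ X (λ x → B → P x)
¬¬-premise x₀ f ¬goal = ¬goal (x₀ , λ b → ⊥-elim (f b λ (x , px) → ¬goal (x , λ _ → px)))

¬¬-pullFin : ∀ {m} {Q : Fin m → Set} → (∀ x → ¬ ¬ Q x) → ¬ ¬ (∀ x → Q x)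
¬¬-pullFin {zero} _ ¬∀ = ¬∀ λ ()
¬¬-pullFin {suc m} ¬¬Q ¬∀ = ¬¬Q Fin.zero λ q₀ → ¬¬-pullFin (¬¬Q ∘ Fin.suc) λ qₛ →
  ¬∀ λ { Fin.zero → q₀ ; (Fin.suc x) → qₛ x }

shift : {X : Set} → ℕ → (ℕ → X) → ℕ → X
shift i f t = f (i + t)

splice : {X : Set} → ℕ → (ℕ → X) → (ℕ → X) → ℕ → X
splice i ρ τ zero = ρ 0
splice zero ρ τ (suc t) = τ t
splice (suc i) ρ τ (suc t) = splice i (ρ ∘ suc) τ t

splice-at : ∀ {X : Set} i (ρ τ : ℕ → X) → splice i ρ τ (suc i) ≡ τ 0
splice-at zero ρ τ = refl
splice-at (suc i) ρ τ = splice-at i (ρ ∘ suc) τ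

module Runs {n k : ℕ} (A : BA n k) where
  open BA A

  IsRun-shift : ∀ {α ρ} i → IsRun A α ρ → IsRun A (shift i α) (shift i ρ)
  IsRun-shift {α} {ρ} i run t =
    subst (λ s → ρ s ∈ δ (ρ (i + t)) (α (i + t))) (sym (+-suc i t)) (run (i + t))

  IsRun-splice : ∀ {α ρ τ} i → IsRun A α ρ → τ 0 ∈ δ (ρ i) (α i) →
    IsRun A (shift (suc i) α) τ → IsRun A α (splice i ρ τ)
  IsRun-splice zero runρ τ₀∈ runτ zero = τ₀∈
  IsRun-splice zero runρ τ₀∈ runτ (suc t) = runτ t
  IsRun-splice (suc i) runρ τ₀∈ runτ zero = runρ 0
  IsRun-splice (suc i) runρ τ₀∈ runτ (suc t) = IsRun-splice i (runρ ∘ suc) τ₀∈ runτ t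

  Vertex-suffixRun : ∀ {α q i} → Vertex A α (q , i) →
    Σ (ℕ → Fin n) λ σ → IsRun A (shift i α) σ × σ 0 ≡ q
  Vertex-suffixRun {i = i} (ρ , _ , run , ρᵢ≡q) =
    shift i ρ , IsRun-shift i run , trans (cong ρ (+-identityʳ i)) ρᵢ≡q

  Vertex-successor : ∀ {α q q' i τ} → Vertex A α (q , i) → q' ∈ δ q (α i) →
    IsRun A (shift (suc i) α) τ → τ 0 ≡ q' → Vertex A α (q' , suc i)
  Vertex-successor {i = i} {τ} (ρ , ρ₀∈I , run , refl) q'∈ runτ refl =
    splice i ρ τ , ρ₀∈I , IsRun-splice i run q'∈ runτ , splice-at i ρ τ

module RunDAG {n k : ℕ} (A : BA n k) (α : Word k) where
  open BA A

  InG⇒Vertex : ∀ j {v} → InG A α j v → Vertex A α v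
  InG⇒Vertex zero v∈G = v∈G
  InG⇒Vertex (suc j) (v∈G , _) = InG⇒Vertex j v∈G

  InG-antitone : ∀ {j l v} → j ≤′ l → InG A α l v → InG A α j v
  InG-antitone ≤′-refl v∈G = v∈G
  InG-antitone (≤′-step j≤′l) (v∈G , _) = InG-antitone j≤′l v∈G

  HasRank⇒Vertex : ∀ {v j} → HasRank A α v (fin j) → Vertex A α v
  HasRank⇒Vertex {j = j} (_ , v∈G , _) = InG⇒Vertex j v∈G

  Removed-map : ∀ j {v w} →
    (IsFinite A α (InG A α j) v → IsFinite A α (InG A α j) w) →
    (Endangered A α (InG A α j) v → Endangered A α (InG A α j) w) →
    Removed A α j v → Removed A α j w
  Removed-map j finite endangered with even? j
  ... | true = finite
  ... | false = endangered

  IsFinite⇒Removed : ∀ {j v} → even? j ≡ true → IsFinite A α (InG A α j) v → Removed A α j v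
  IsFinite⇒Removed {j} _ finite with even? j
  IsFinite⇒Removed refl finite | true = finite

  Endangered⇒Removed : ∀ {j v} → even? j ≡ false → Endangered A α (InG A α j) v → Removed A α j v
  Endangered⇒Removed {j} _ endangered with even? j
  Endangered⇒Removed refl endangered | false = endangered

  Removed⇒IsFinite : ∀ {j v} → even? j ≡ true → Removed A α j v → IsFinite A α (InG A α j) v
  Removed⇒IsFinite {j} _ removed with even? j
  Removed⇒IsFinite refl removed | true = removed

  Removed⇒Endangered : ∀ {j v} → even? j ≡ false → Removed A α j v → Endangered A α (InG A α j) v
  Removed⇒Endangered {j} _ removed with even? j
  Removed⇒Endangered refl removed | false = removed

  module _ {G : V n → Set} where

    Reach-source : ∀ {v w} → Reach A α G v w → G v
    Reach-source (here v∈G) = v∈G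
    Reach-source (next v∈G _ _) = v∈G

    IsFinite⇒levelBounded : ∀ {v} → IsFinite A α G v →
      Σ ℕ λ N → ∀ w → Reach A α G v w → proj₂ w ≤ N
    IsFinite⇒levelBounded (L , reach⇒∈L) =
      max 0 (map proj₂ L) ,
      λ w v⇝w → All.lookup (xs≤max 0 (map proj₂ L)) (∈-map⁺ proj₂ (reach⇒∈L w v⇝w))

    levelBounded⇒IsFinite : ∀ {v} N → (∀ w → Reach A α G v w → proj₂ w ≤ N) → IsFinite A α G v
    levelBounded⇒IsFinite N bounded =
      cartesianProduct (allFin n) (upTo (suc N)) ,
      λ w v⇝w → ∈-cartesianProduct⁺ (∈-allFin (proj₁ w)) (∈-upTo⁺ (s≤s (bounded w v⇝w)))

    IsFinite-fromSuccessors : ∀ {p i} →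
      (∀ q → Σ (List (V n)) λ L → Edge A α (p , i) (q , suc i) × G (q , suc i) →
        ∀ w → Reach A α G (q , suc i) w → w List.∈ L) →
      IsFinite A α G (p , i)
    IsFinite-fromSuccessors {p} {i} succLists =
      (p , i) ∷ succVertices , reach⇒∈
      where
      succVertices : List (V n)
      succVertices = concatMap (proj₁ ∘ succLists) (allFin n)
      reach⇒∈ : ∀ w → Reach A α G (p , i) w → w List.∈ ((p , i) ∷ succVertices)
      reach⇒∈ w (here _) = here refl
      reach⇒∈ w (next {v = q , _} _ e@(_ , _ , refl , _) q⇝w) =
        there (∈-concatMap⁺ (proj₁ ∘ succLists)
          (List.lose (∈-allFin q) (proj₂ (succLists q) (e , Reach-source q⇝w) w q⇝w)))

    ¬IsFinite⇒¬¬infiniteSuccessor : ∀ {p i} → ¬ IsFinite A α G (p , i) →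
      ¬ ¬ (Σ (Fin n) λ q → Edge A α (p , i) (q , suc i) × G (q , suc i) × ¬ IsFinite A α G (q , suc i))
    ¬IsFinite⇒¬¬infiniteSuccessor ¬finite ¬successor =
      ¬¬-pullFin (λ q → ¬¬-premise [] λ (e , q∈G) ¬finiteq → ¬successor (q , e , q∈G , ¬finiteq))
        (¬finite ∘ IsFinite-fromSuccessors)

    Endangered-successor : ∀ {v w} → G v → Edge A α v w → Endangered A α G v → Endangered A α G w
    Endangered-successor v∈G e endangered (u , w⇝u , u∈F) = endangered (u , next v∈G e w⇝u , u∈F)

    Endangered⇒∉F : ∀ {v} → G v → Endangered A α G v → proj₁ v ∉ F
    Endangered⇒∉F v∈G endangered v∈F = endangered (_ , here v∈G , v∈F)

  oddRank-successor : ∀ {q i j} → HasRank A α (q , i) (fin j) → Odd j →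
    ¬ ¬ (Σ (Fin n) λ q' → q' ∈ δ q (α i) × q' ∉ F × HasRank A α (q' , suc i) (fin j))
  oddRank-successor {q} {i} {suc j} (j≤ , (v∈G , v-kept) , v-removed) odd =
    ¬¬-map rankedSuccessor (¬IsFinite⇒¬¬infiniteSuccessor (v-kept ∘ IsFinite⇒Removed j-even))
    where
    1+j-odd : even? (suc j) ≡ false
    1+j-odd = even?-odd (suc j) odd
    j-even : even? j ≡ true
    j-even = even?-pred j 1+j-odd
    rankedSuccessor : (Σ (Fin n) λ q' → Edge A α (q , i) (q' , suc i) × InG A α j (q' , suc i) ×
                                        ¬ IsFinite A α (InG A α j) (q' , suc i)) →
      Σ (Fin n) λ q' → q' ∈ δ q (α i) × q' ∉ F × HasRank A α (q' , suc i) (fin (suc j))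
    rankedSuccessor (q' , e , w∈Gj , ¬finite) =
      q' , proj₂ (proj₂ (proj₂ e)) , Endangered⇒∉F w∈G w-endangered ,
      j≤ , w∈G , Endangered⇒Removed 1+j-odd w-endangered
      where
      w∈G : InG A α (suc j) (q' , suc i)
      w∈G = w∈Gj , ¬finite ∘ Removed⇒IsFinite j-even
      w-endangered : Endangered A α (InG A α (suc j)) (q' , suc i)
      w-endangered = Endangered-successor (v∈G , v-kept) e (Removed⇒Endangered 1+j-odd v-removed)

module DirectSimulation {n k : ℕ} (A : BA n k) (R : Fin n → Fin n → Set) (sim : IsDirectSim A R) where
  open BA A
  open Runs A

  sim-step : ∀ {p q a p'} → R p q → p' ∈ δ p a → Σ (Fin n) λ q' → q' ∈ δ q a × R p' q'
  sim-step {p} {q} {a} {p'} Rpq p'∈ = proj₂ (sim p q Rpq) a p' p'∈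

  simulatingRun : ∀ {β σ q} → IsRun A β σ → R (σ 0) q → ∀ t → Σ (Fin n) (R (σ t))
  simulatingRun {q = q} _ R₀ zero = q , R₀
  simulatingRun run R₀ (suc t) =
    let q' , _ , Rq' = sim-step (proj₂ (simulatingRun run R₀ t)) (run t) in q' , Rq'

  simulatingRun-IsRun : ∀ {β σ q} (run : IsRun A β σ) (R₀ : R (σ 0) q) →
    IsRun A β (proj₁ ∘ simulatingRun run R₀)
  simulatingRun-IsRun run R₀ t = proj₁ (proj₂ (sim-step (proj₂ (simulatingRun run R₀ t)) (run t)))

  Vertex-simulatingSuccessor : ∀ {α r i p' r'} → Vertex A α (r , i) → r' ∈ δ r (α i) → R p' r' →
    Vertex A α (p' , suc i) → Vertex A α (r' , suc i)
  Vertex-simulatingSuccessor vr r'∈ Rp'r' vp' with σ , runσ , refl ← Vertex-suffixRun vp' =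
    Vertex-successor vr r'∈ (simulatingRun-IsRun runσ Rp'r') refl

  module _ (α : Word k) where
    open RunDAG A α

    R-Closed : ℕ → Set
    R-Closed j = ∀ {p r i} → R p r → InG A α j (p , i) → Vertex A α (r , i) → InG A α j (r , i)

    Reach-simulated : ∀ {j p r i w} → R-Closed j → R p r → Vertex A α (r , i) →
      Reach A α (InG A α j) (p , i) w →
      Σ (Fin n) λ q → R (proj₁ w) q × Reach A α (InG A α j) (r , i) (q , proj₂ w)
    Reach-simulated closed Rpr vr (here p∈G) = _ , Rpr , here (closed Rpr p∈G vr)
    Reach-simulated closed Rpr vr (next p∈G (_ , vp' , refl , p'∈) p'⇝w) =
      let r' , r'∈ , Rp'r' = sim-step Rpr p'∈
          vr' = Vertex-simulatingSuccessor vr r'∈ Rp'r' vp'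
          q , Rwq , r'⇝q = Reach-simulated closed Rp'r' vr' p'⇝w
      in q , Rwq , next (closed Rpr p∈G vr) (vr , vr' , refl , r'∈) r'⇝q

    IsFinite-reflected : ∀ {j p r i} → R-Closed j → R p r → Vertex A α (r , i) →
      IsFinite A α (InG A α j) (r , i) → IsFinite A α (InG A α j) (p , i)
    IsFinite-reflected closed Rpr vr finite =
      let N , bounded = IsFinite⇒levelBounded finite in
      levelBounded⇒IsFinite N λ w p⇝w →
        let _ , _ , r⇝ = Reach-simulated closed Rpr vr p⇝w in bounded _ r⇝

    Endangered-reflected : ∀ {j p r i} → R-Closed j → R p r → Vertex A α (r , i) →
      Endangered A α (InG A α j) (r , i) → Endangered A α (InG A α j) (p , i)
    Endangered-reflected closed Rpr vr endangered (w , p⇝w , w∈F) =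
      let q , Rwq , r⇝q = Reach-simulated closed Rpr vr p⇝w in
      endangered ((q , proj₂ w) , r⇝q , proj₁ (sim _ _ Rwq) w∈F)

    InG-closed : ∀ j → R-Closed j
    InG-closed zero _ _ vr = vr
    InG-closed (suc j) Rpr (p∈G , p-kept) vr =
      InG-closed j Rpr p∈G vr ,
      p-kept ∘ Removed-map j (IsFinite-reflected (InG-closed j) Rpr vr)
                             (Endangered-reflected (InG-closed j) Rpr vr)

    rank-≤ : ∀ {p r i j l} → R p r → Vertex A α (r , i) →
      HasRank A α (p , i) (fin j) → HasRank A α (r , i) (fin l) → j ≤ l
    rank-≤ {l = l} Rpr vr (_ , p∈G , _) (_ , _ , r-removed) = ≮⇒≥ λ l<j →
      proj₂ (InG-closed (suc l) Rpr (InG-antitone (≤⇒≤′ l<j) p∈G) vr) r-removed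

lemma8 : ∀ {n m : ℕ} (A : BA n (suc m)) (p r : Fin n) →
    _≼R_ A p r → _≼ors_ A p r
lemma8 A p r (di (R , sim , Rpr)) α i j l _ vr hp hr _ _ = DirectSimulation.rank-≤ A R sim α Rpr vr hp hr
lemma8 A p r (step next≼R) α i j l _ _ hp hr odd-j odd-l = decidable-stable (j ≤? l) λ j≰l →
  oddRank-successor hp odd-j λ (x , x∈ , x∉F , hx) →
  oddRank-successor hr odd-l λ (y , y∈ , y∉F , hy) →
  j≰l (lemma8 A x y (next≼R (α i) x y x∈ x∉F y∈ y∉F) α (suc i) j l
        (HasRank⇒Vertex hx) (HasRank⇒Vertex hy) hx hy odd-j odd-l)
  where open RunDAG A α
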